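{- Let $\mu$ be a nonempty skew Young diagram and $T$ a (non-set-valued) tableau on $\mu$. A division of $\mu$ is a partition $\mu=\mu_S\sqcup\mu_R$ into two skew shapes such that $\mu_S$ is an order ideal of $\mu$ under $\preceq$. Say the division $(\mu_S,\mu_R)$ is allowed by $T$ if $T$ restricted to $\mu_S$ is semistandard and $T$ restricted to $\mu_R$ is reverse row-strict. Then $$\sum_{(\mu_S,\mu_R)\text{ allowed by }T}(-1)^{|\mu_S|}=0.$$
   Context: Boxes are pairs $(i,j)$ of positive integers, $i$ the row index (increasing downward), $j$ the column index (increasing to the right); $(i,j)\preceq(i',j')$ iff $i\le i'$ and $j\le j'$. A skew Young diagram (skew shape) is a finite set of boxes closed under intervals (if $a,c$ are in it and $a\preceq b\preceq c$ then $b$ is in it). An order ideal of $\mu$ is a subset closed downward under $\preceq$ within $\mu$. A tableau assigns a positive integer to each box; it is semistandard if rows weakly increase left to right and columns strictly increase top to bottom, and reverse row-strict if rows strictly decrease left to right and columns weakly decrease top to bottom. -}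

module Defs where

open import Data.Nat using (ℕ; zero; suc; _≤_; _<_; _≤?_; _<?_; s≤s)
open import Data.Nat.Properties using () renaming (_≟_ to _≟ℕ_)
open import Data.Integer using (ℤ; 0ℤ; 1ℤ; -_; _+_)
open import Data.Product using (_×_; _,_; proj₁; proj₂)
open import Data.Product.Properties using (≡-dec)
open import Data.List using (List; []; _∷_; map; filter; length; foldr)
open import Data.List.Relation.Unary.All as All using (All)
open import Data.Fin using (Fin; toℕ; fromℕ<)
open import Data.Fin.Properties using (all?; toℕ-fromℕ<)
open import Relation.Binary.PropositionalEquality using (_≡_; refl; subst; sym)
open import Relation.Binary.Definitions using (DecidableEquality)
open import Relation.Nullary using (Dec; yes; no; ¬_)
open import Relation.Nullary.Decidable using (map′; _×-dec_; _→-dec_)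

-- A box (i , j): i = row index (increasing downward), j = column index.
Box : Set
Box = ℕ × ℕ

row col : Box → ℕ
row = proj₁
col = proj₂

_⪯_ : Box → Box → Set
a ⪯ b = (row a ≤ row b) × (col a ≤ col b)

_≟B_ : DecidableEquality Box
_≟B_ = ≡-dec _≟ℕ_ _≟ℕ_

open import Data.List.Membership.DecPropositional _≟B_ public
  using (_∈_; _∉_; _∈?_)

PositiveBox : Box → Set
PositiveBox a = (0 < row a) × (0 < col a)

-- Finite sets of boxes are represented by duplicate-free lists.

IntervalClosed : List Box → Set
IntervalClosed S = ∀ {a b c} → a ∈ S → c ∈ S → a ⪯ b → b ⪯ c → b ∈ S

SkewShape : List Box → Set
SkewShape = IntervalClosed

OrderIdeal : List Box → List Box → Set
OrderIdeal S μ = ∀ {a b} → b ∈ S → a ∈ μ → a ⪯ b → a ∈ S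

Tableau : Set
Tableau = Box → ℕ

Semistandard : Tableau → List Box → Set
Semistandard T S =
  (∀ {a b} → a ∈ S → b ∈ S → row a ≡ row b → col a < col b → T a ≤ T b) ×
  (∀ {a b} → a ∈ S → b ∈ S → col a ≡ col b → row a < row b → T a < T b)

ReverseRowStrict : Tableau → List Box → Set
ReverseRowStrict T R =
  (∀ {a b} → a ∈ R → b ∈ R → row a ≡ row b → col a < col b → T b < T a) ×
  (∀ {a b} → a ∈ R → b ∈ R → col a ≡ col b → row a < row b → T b ≤ T a)

-- All ways to split a list into two complementary sublists (each element
-- goes either to the left or to the right part). For a duplicate-free μ
-- these are exactly the partitions μ = S ⊔ R.
splits : {A : Set} → List A → List (List A × List A)
splits [] = ([] , []) ∷ []
splits (x ∷ xs) =
  Data.List.concatMap (λ p → (x ∷ proj₁ p , proj₂ p) ∷ (proj₁ p , x ∷ proj₂ p) ∷ [])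
    (splits xs)
  where import Data.List

Division : List Box → List Box × List Box → Set
Division μ (S , R) = SkewShape S × SkewShape R × OrderIdeal S μ

Allowed : Tableau → List Box → List Box × List Box → Set
Allowed T μ (S , R) = Division μ (S , R) × Semistandard T S × ReverseRowStrict T R

private
  ∀∈? : {L : List Box} {P : Box → Set} → (∀ a → Dec (P a)) →
        Dec (∀ {a} → a ∈ L → P a)
  ∀∈? {L} P? = map′ (λ h → All.lookup h) (λ h → All.tabulate h) (All.all? P? L)

  ⪯? : ∀ a b → Dec (a ⪯ b)
  ⪯? a b = (row a ≤? row b) ×-dec (col a ≤? col b)

  ∀box? : (c : Box) {P : Box → Set} → (∀ b → Dec (P b)) →
          Dec (∀ b → b ⪯ c → P b)
  ∀box? (c₁ , c₂) {P} P? =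
    map′ fwd bwd (all? (λ i → all? (λ j → P? (toℕ i , toℕ j))))
    where
    fwd : (∀ (i : Fin (suc c₁)) (j : Fin (suc c₂)) → P (toℕ i , toℕ j)) →
          ∀ b → b ⪯ (c₁ , c₂) → P b
    fwd h (x , y) (x≤ , y≤) =
      subst (λ u → P (u , y)) (toℕ-fromℕ< (s≤s x≤))
        (subst (λ v → P (toℕ (fromℕ< (s≤s x≤)) , v)) (toℕ-fromℕ< (s≤s y≤))
          (h (fromℕ< (s≤s x≤)) (fromℕ< (s≤s y≤))))
    bwd : (∀ b → b ⪯ (c₁ , c₂) → P b) →
          ∀ (i : Fin (suc c₁)) (j : Fin (suc c₂)) → P (toℕ i , toℕ j)
    bwd h i j = h (toℕ i , toℕ j) (lt i , lt j)
      where
      lt : ∀ {n} (k : Fin (suc n)) → toℕ k ≤ n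
      lt {n} k = Data.Nat.Properties.≤-pred (Data.Fin.Properties.toℕ<n k)
        where import Data.Nat.Properties; import Data.Fin.Properties

intervalClosed? : ∀ S → Dec (IntervalClosed S)
intervalClosed? S =
  map′ (λ h {a} {b} {c} a∈ c∈ a⪯b b⪯c → h a∈ c∈ b b⪯c a⪯b)
       (λ h {a} a∈ {c} c∈ b b⪯c a⪯b → h a∈ c∈ a⪯b b⪯c)
    (∀∈? {S} (λ a → ∀∈? {S} (λ c → ∀box? c (λ b → ⪯? a b →-dec (b ∈? S)))))

orderIdeal? : ∀ S μ → Dec (OrderIdeal S μ)
orderIdeal? S μ =
  map′ (λ h b∈ a∈ a⪯b → h b∈ a∈ a⪯b) (λ h {b} b∈ {a} a∈ a⪯b → h b∈ a∈ a⪯b)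
    (∀∈? {S} (λ b → ∀∈? {μ} (λ a → ⪯? a b →-dec (a ∈? S))))

private
  pairs? : {L : List Box} {P : Box → Box → Set} → (∀ a b → Dec (P a b)) →
           Dec (∀ {a b} → a ∈ L → b ∈ L → P a b)
  pairs? {L} P? =
    map′ (λ h a∈ b∈ → h a∈ b∈) (λ h {a} a∈ {b} b∈ → h a∈ b∈)
      (∀∈? {L} (λ a → ∀∈? {L} (λ b → P? a b)))

semistandard? : ∀ T S → Dec (Semistandard T S)
semistandard? T S =
  pairs? (λ a b → (row a ≟ℕ row b) →-dec ((col a <? col b) →-dec (T a ≤? T b)))
  ×-dec
  pairs? (λ a b → (col a ≟ℕ col b) →-dec ((row a <? row b) →-dec (T a <? T b)))

reverseRowStrict? : ∀ T R → Dec (ReverseRowStrict T R)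
reverseRowStrict? T R =
  pairs? (λ a b → (row a ≟ℕ row b) →-dec ((col a <? col b) →-dec (T b <? T a)))
  ×-dec
  pairs? (λ a b → (col a ≟ℕ col b) →-dec ((row a <? row b) →-dec (T b ≤? T a)))

division? : ∀ μ p → Dec (Division μ p)
division? μ (S , R) = intervalClosed? S ×-dec (intervalClosed? R ×-dec orderIdeal? S μ)

allowed? : ∀ T μ p → Dec (Allowed T μ p)
allowed? T μ (S , R) =
  division? μ (S , R) ×-dec (semistandard? T S ×-dec reverseRowStrict? T R)

sign : ℕ → ℤ
sign zero = 1ℤ
sign (suc n) = - sign n

sumℤ : List ℤ → ℤ
sumℤ = foldr _+_ 0ℤ

allowedSignedSum : Tableau → List Box → ℤ
allowedSignedSum T μ =
  sumℤ (map (λ p → sign (length (proj₁ p))) (filter (allowed? T μ) (splits μ)))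

-- Let w be a box of μ carrying the largest entry of T, chosen topmost and then
-- rightmost among those.  For any split (S , R) of the remaining boxes, the
-- division (w ∷ S , R) is allowed exactly when (S , w ∷ R) is: w is a maximal
-- box of the semistandard part and a minimal box of the reverse row-strict part,
-- and its entry is compatible with both fillings.  Moving w between the two parts
-- changes |μ_S| by one, so the allowed divisions cancel in pairs.
module Submission where

open import Defs
open import Data.Bool using (Bool; true; false; if_then_else_)
open import Data.Empty using (⊥)
open import Data.Integer using (ℤ; 0ℤ; _+_; -_)
open import Data.Integer.Properties using (+-identityˡ; +-assoc; +-inverseˡ; +-commutativeSemigroup)
open import Algebra.Properties.CommutativeSemigroup +-commutativeSemigroup using (interchange)
open import Data.List using (List; []; _∷_; _++_; map; filter; length; concatMap)
import Data.List.Extrema as Extrema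
open import Data.List.Membership.Propositional.Properties
  using (∈-++⁺ˡ; ∈-++⁺ʳ; ∈-++⁻; ∈-∃++)
open import Data.List.Properties using (map-cong)
open import Data.List.Relation.Binary.Disjoint.Propositional using (Disjoint)
open import Data.List.Relation.Binary.Permutation.Propositional
  using (_↭_; ↭-refl; ↭-sym; ↭-trans; ↭-reflexive; ↭-prep; ↭-swap; ↭⇒↭ₛ)
import Data.List.Relation.Binary.Permutation.Propositional as ↭
open import Data.List.Relation.Binary.Permutation.Propositional.Properties
  using (∈-resp-↭; ↭-length; shift)
open import Relation.Binary.PropositionalEquality.Properties using () renaming (setoid to ≡-setoid)
open import Data.List.Relation.Binary.Permutation.Setoid.Properties (≡-setoid Box) using (Unique-resp-↭)
open import Data.List.Relation.Binary.Subset.Propositional using (_⊆_)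
open import Data.List.Relation.Ternary.Interleaving.Propositional
  using (Interleaving; []; consˡ; consʳ; toPermutation)
open import Data.List.Relation.Unary.All as All using (All; []; _∷_)
open import Data.List.Relation.Unary.All.Properties using (concat⁺; map⁺)
open import Data.List.Relation.Unary.AllPairs as AllPairs using (_∷_)
open import Data.List.Relation.Unary.Any using (here; there)
open import Data.List.Relation.Unary.Unique.Propositional using (Unique)
open import Data.List.Relation.Unary.Unique.Propositional.Properties using (Unique[x∷xs]⇒x∉xs)
open import Data.Nat using (ℕ; _≤_; _<_)
open import Data.Nat.Properties
  using ( ≤-decTotalOrder; ≤-totalOrder; ≤-refl; ≤-reflexive; <⇒≤; <⇒≱; <-irrefl; ≤-<-trans
        ; ≤∧≢⇒<; m≤n⇒m<n∨m≡n)
open import Data.Product using (_×_; _,_; proj₁; ∃-syntax)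
open import Data.Product.Relation.Binary.Lex.NonStrict using (×-totalOrder)
open import Data.Sum using (_⊎_; inj₁; inj₂)
open import Function using (_∘_)
open import Function.Bundles using (mk⇔)
open import Relation.Binary.Bundles using (TotalOrder)
import Relation.Binary.Construct.Flip.EqAndOrd as Flip
open import Relation.Binary.PropositionalEquality
  using (_≡_; _≢_; refl; cong; cong₂; sym; trans; subst; module ≡-Reasoning)
open import Relation.Nullary using (¬_; does; contradiction)
open import Relation.Nullary.Decidable using (does-⇔)
open import Relation.Unary using (Decidable)

sumℤ-map-filter : ∀ {A : Set} {P : A → Set} (P? : Decidable P) (h : A → ℤ) (xs : List A) →
                  sumℤ (map h (filter P? xs))
                  ≡ sumℤ (map (λ x → if does (P? x) then h x else 0ℤ) xs)
sumℤ-map-filter P? h []       = refl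
sumℤ-map-filter P? h (x ∷ xs) with does (P? x)
... | true  = cong (h x +_) (sumℤ-map-filter P? h xs)
... | false = trans (sumℤ-map-filter P? h xs) (sym (+-identityˡ _))

sumℤ-map-zero : ∀ {A : Set} {h : A → ℤ} {xs : List A} →
                All (λ x → h x ≡ 0ℤ) xs → sumℤ (map h xs) ≡ 0ℤ
sumℤ-map-zero []             = refl
sumℤ-map-zero (hx≡0 ∷ hxs≡0) = cong₂ _+_ hx≡0 (sumℤ-map-zero hxs≡0)

if-neg-cancel : ∀ (b : Bool) (s : ℤ) → (if b then - s else 0ℤ) + (if b then s else 0ℤ) ≡ 0ℤ
if-neg-cancel true  s = +-inverseˡ s
if-neg-cancel false s = refl

Unique-++⇒Disjoint : ∀ {A : Set} (xs : List A) {ys} → Unique (xs ++ ys) → Disjoint xs ys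
Unique-++⇒Disjoint (x ∷ xs) (x∉ ∷ _)  (here refl , v∈ys)  = All.lookup x∉ (∈-++⁺ʳ xs v∈ys) refl
Unique-++⇒Disjoint (x ∷ xs) (_ ∷ xs!) (there v∈xs , v∈ys) =
  Unique-++⇒Disjoint xs xs! (v∈xs , v∈ys)

∈⇒↭∷ : ∀ {x : Box} {xs} → x ∈ xs → ∃[ ys ] xs ↭ x ∷ ys
∈⇒↭∷ {x = x} x∈xs with ys , zs , xs≡ ← ∈-∃++ x∈xs =
  ys ++ zs , ↭-trans (↭-reflexive xs≡) (shift x ys zs)

module _ {A : Set} where

  Split : Set
  Split = List A × List A

  Σsplits : List A → (Split → ℤ) → ℤ
  Σsplits xs f = sumℤ (map f (splits xs))

  place : A → (Split → ℤ) → Split → ℤ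
  place x f (S , R) = f (x ∷ S , R) + f (S , x ∷ R)

  Σsplits-∷ : ∀ x xs f → Σsplits (x ∷ xs) f ≡ Σsplits xs (place x f)
  Σsplits-∷ x xs f = go (splits xs)
    where
    go : ∀ ps → sumℤ (map f (concatMap (λ (S , R) → (x ∷ S , R) ∷ (S , x ∷ R) ∷ []) ps))
              ≡ sumℤ (map (place x f) ps)
    go []             = refl
    go ((S , R) ∷ ps) = trans (sym (+-assoc (f (x ∷ S , R)) _ _)) (cong (place x f (S , R) +_) (go ps))

  Σsplits-cong : ∀ xs {f g} → (∀ p → f p ≡ g p) → Σsplits xs f ≡ Σsplits xs g
  Σsplits-cong xs f≗g = cong sumℤ (map-cong f≗g (splits xs))

  PermInvariant : (Split → ℤ) → Set
  PermInvariant f = ∀ {S S′ R R′} → S ↭ S′ → R ↭ R′ → f (S , R) ≡ f (S′ , R′)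

  place-invariant : ∀ x {f} → PermInvariant f → PermInvariant (place x f)
  place-invariant x inv S↭ R↭ = cong₂ _+_ (inv (↭-prep x S↭) R↭) (inv S↭ (↭-prep x R↭))

  place-comm : ∀ x y {f} → PermInvariant f → ∀ p → place x (place y f) p ≡ place y (place x f) p
  place-comm x y {f} inv (S , R) = begin
    (f (y ∷ x ∷ S , R) + f (x ∷ S , y ∷ R)) + (f (y ∷ S , x ∷ R) + f (S , y ∷ x ∷ R))
      ≡⟨ cong₂ (λ a d → (a + f (x ∷ S , y ∷ R)) + (f (y ∷ S , x ∷ R) + d))
               (inv (↭-swap y x ↭-refl) ↭-refl) (inv ↭-refl (↭-swap y x ↭-refl)) ⟩
    (f (x ∷ y ∷ S , R) + f (x ∷ S , y ∷ R)) + (f (y ∷ S , x ∷ R) + f (S , x ∷ y ∷ R))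
      ≡⟨ interchange (f (x ∷ y ∷ S , R)) (f (x ∷ S , y ∷ R))
                     (f (y ∷ S , x ∷ R)) (f (S , x ∷ y ∷ R)) ⟩
    (f (x ∷ y ∷ S , R) + f (y ∷ S , x ∷ R)) + (f (x ∷ S , y ∷ R) + f (S , x ∷ y ∷ R))
      ∎
    where open ≡-Reasoning

  Σsplits-resp-↭ : ∀ {xs ys f} → PermInvariant f → xs ↭ ys → Σsplits xs f ≡ Σsplits ys f
  Σsplits-resp-↭ inv ↭.refl = refl
  Σsplits-resp-↭ {f = f} inv (↭.prep {xs = xs} {ys = ys} x xs↭ys) = begin
    Σsplits (x ∷ xs) f      ≡⟨ Σsplits-∷ x xs f ⟩
    Σsplits xs (place x f)  ≡⟨ Σsplits-resp-↭ (place-invariant x {f} inv) xs↭ys ⟩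
    Σsplits ys (place x f)  ≡⟨ Σsplits-∷ x ys f ⟨
    Σsplits (x ∷ ys) f      ∎
    where open ≡-Reasoning
  Σsplits-resp-↭ {f = f} inv (↭.swap {xs = xs} {ys = ys} x y xs↭ys) = begin
    Σsplits (x ∷ y ∷ xs) f            ≡⟨ trans (Σsplits-∷ x (y ∷ xs) f) (Σsplits-∷ y xs (place x f)) ⟩
    Σsplits xs (place y (place x f))
      ≡⟨ Σsplits-resp-↭ (place-invariant y {place x f} (place-invariant x inv)) xs↭ys ⟩
    Σsplits ys (place y (place x f))  ≡⟨ Σsplits-cong ys (place-comm y x {f} inv) ⟩
    Σsplits ys (place x (place y f))  ≡⟨ trans (Σsplits-∷ y (x ∷ ys) f) (Σsplits-∷ x ys (place y f)) ⟨
    Σsplits (y ∷ x ∷ ys) f            ∎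
    where open ≡-Reasoning
  Σsplits-resp-↭ inv (↭.trans xs↭ys ys↭zs) = trans (Σsplits-resp-↭ inv xs↭ys) (Σsplits-resp-↭ inv ys↭zs)

  splits-interleaving : ∀ xs → All (λ (S , R) → Interleaving S R xs) (splits {A} xs)
  splits-interleaving []       = [] ∷ []
  splits-interleaving (x ∷ xs) =
    concat⁺ (map⁺ (All.map (λ S⋎R → consˡ S⋎R ∷ consʳ S⋎R ∷ []) (splits-interleaving xs)))

  Σsplits-zero : ∀ xs {f} → (∀ {S R} → Interleaving S R xs → f (S , R) ≡ 0ℤ) → Σsplits xs f ≡ 0ℤ
  Σsplits-zero xs f≡0 = sumℤ-map-zero (All.map f≡0 (splits-interleaving xs))

corner∈ : ∀ {X a b} → IntervalClosed X → a ∈ X → b ∈ X → a ⪯ b → (row a , col b) ∈ X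
corner∈ X-skew a∈X b∈X (r≤ , c≤) = X-skew a∈X b∈X (≤-refl , c≤) (r≤ , ≤-refl)

module _ {T : Tableau} {X : List Box} (X-skew : IntervalClosed X) where

  semistandard-strict-down : Semistandard T X →
                             ∀ {a b} → a ∈ X → b ∈ X → a ⪯ b → row a < row b → T a < T b
  semistandard-strict-down (ss-row , ss-col) {a} {b} a∈X b∈X a⪯b@(_ , c≤) r< =
    ≤-<-trans Ta≤Tc (ss-col c∈X b∈X refl r<)
    where
    c∈X : (row a , col b) ∈ X
    c∈X = corner∈ X-skew a∈X b∈X a⪯b
    Ta≤Tc : T a ≤ T (row a , col b)
    Ta≤Tc with m≤n⇒m<n∨m≡n c≤
    ... | inj₁ c< = ss-row a∈X c∈X refl c<
    ... | inj₂ c≡ = ≤-reflexive (cong (λ j → T (row a , j)) c≡)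

  reverseRowStrict-strict-right : ReverseRowStrict T X →
                                  ∀ {a b} → a ∈ X → b ∈ X → a ⪯ b → col a < col b → T b < T a
  reverseRowStrict-strict-right (rr-row , rr-col) {a} {b} a∈X b∈X a⪯b@(r≤ , _) c< =
    ≤-<-trans Tb≤Tc (rr-row a∈X c∈X refl c<)
    where
    c∈X : (row a , col b) ∈ X
    c∈X = corner∈ X-skew a∈X b∈X a⪯b
    Tb≤Tc : T b ≤ T (row a , col b)
    Tb≤Tc with m≤n⇒m<n∨m≡n r≤
    ... | inj₁ r< = rr-col c∈X b∈X refl r<
    ... | inj₂ r≡ = ≤-reflexive (cong (λ i → T (i , col b)) (sym r≡))

semistandard-⊆ : ∀ {T X Y} → Y ⊆ X → Semistandard T X → Semistandard T Y
semistandard-⊆ Y⊆X (ss-row , ss-col) =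
  (λ a∈ b∈ → ss-row (Y⊆X a∈) (Y⊆X b∈)) , (λ a∈ b∈ → ss-col (Y⊆X a∈) (Y⊆X b∈))

reverseRowStrict-⊆ : ∀ {T X Y} → Y ⊆ X → ReverseRowStrict T X → ReverseRowStrict T Y
reverseRowStrict-⊆ Y⊆X (rr-row , rr-col) =
  (λ a∈ b∈ → rr-row (Y⊆X a∈) (Y⊆X b∈)) , (λ a∈ b∈ → rr-col (Y⊆X a∈) (Y⊆X b∈))

Allowed-resp-↭ : ∀ {T μ S S′ R R′} → S ↭ S′ → R ↭ R′ →
                 Allowed T μ (S , R) → Allowed T μ (S′ , R′)
Allowed-resp-↭ {S = S} {S′} {R} {R′} S↭ R↭ ((S-skew , R-skew , S-ideal) , S-ss , R-rrs) =
  ( (λ a∈ c∈ a⪯b b⪯c → S⊆S′ (S-skew (S′⊆S a∈) (S′⊆S c∈) a⪯b b⪯c))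
  , (λ a∈ c∈ a⪯b b⪯c → R⊆R′ (R-skew (R′⊆R a∈) (R′⊆R c∈) a⪯b b⪯c))
  , (λ b∈ a∈μ a⪯b → S⊆S′ (S-ideal (S′⊆S b∈) a∈μ a⪯b)) )
  , semistandard-⊆ S′⊆S S-ss , reverseRowStrict-⊆ R′⊆R R-rrs
  where
  S⊆S′ : S ⊆ S′
  S⊆S′ = ∈-resp-↭ S↭
  S′⊆S : S′ ⊆ S
  S′⊆S = ∈-resp-↭ (↭-sym S↭)
  R⊆R′ : R ⊆ R′
  R⊆R′ = ∈-resp-↭ R↭
  R′⊆R : R′ ⊆ R
  R′⊆R = ∈-resp-↭ (↭-sym R↭)

signedIndicator : Tableau → List Box → List Box × List Box → ℤ
signedIndicator T μ (S , R) = if does (allowed? T μ (S , R)) then sign (length S) else 0ℤ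

signedIndicator-invariant : ∀ T μ → PermInvariant (signedIndicator T μ)
signedIndicator-invariant T μ {S} {S′} {R} {R′} S↭ R↭ =
  cong₂ (λ b s → if b then s else 0ℤ)
        (does-⇔ (mk⇔ (Allowed-resp-↭ {T} {μ} S↭ R↭)
                     (Allowed-resp-↭ (↭-sym S↭) (↭-sym R↭)))
                  (allowed? T μ (S , R)) (allowed? T μ (S′ , R′)))
        (cong sign (↭-length S↭))

record Pivot (T : Tableau) (μ : List Box) (w : Box) : Set where
  field
    maximal      : ∀ {b} → b ∈ μ → T b ≤ T w
    larger-right : ∀ {b} → b ∈ μ → row b ≡ row w → col w < col b → T b < T w
    larger-above : ∀ {b} → b ∈ μ → col b ≡ col w → row b < row w → T b < T w

-- Lexicographic: entry, then row reversed (topmost wins), then column.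
keyOrder : TotalOrder _ _ _
keyOrder =
  ×-totalOrder ≤-decTotalOrder (×-totalOrder (Flip.decTotalOrder ≤-decTotalOrder) ≤-totalOrder)

open TotalOrder keyOrder using () renaming (_≤_ to _≤ₖ_)
open Extrema keyOrder using (argmax; argmax-sel; f[⊥]≤f[argmax]; f[xs]≤f[argmax])

key : Tableau → Box → ℕ × ℕ × ℕ
key T b = T b , row b , col b

key-maximal⇒Pivot : ∀ T μ w → (∀ {b} → b ∈ μ → key T b ≤ₖ key T w) → Pivot T μ w
key-maximal⇒Pivot T μ w key≤ = record
  { maximal = entry≤ ∘ key≤ ; larger-right = larger-right ; larger-above = larger-above }
  where
  entry≤ : ∀ {b} → key T b ≤ₖ key T w → T b ≤ T w
  entry≤ (inj₁ (Tb≤Tw , _)) = Tb≤Tw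
  entry≤ (inj₂ (Tb≡Tw , _)) = ≤-reflexive Tb≡Tw

  larger-right : ∀ {b} → b ∈ μ → row b ≡ row w → col w < col b → T b < T w
  larger-right b∈μ r≡ c< with key≤ b∈μ
  ... | inj₁ (Tb≤Tw , Tb≢Tw)     = ≤∧≢⇒< Tb≤Tw Tb≢Tw
  ... | inj₂ (_ , inj₁ (_ , r≢)) = contradiction r≡ r≢
  ... | inj₂ (_ , inj₂ (_ , c≤)) = contradiction c≤ (<⇒≱ c<)

  larger-above : ∀ {b} → b ∈ μ → col b ≡ col w → row b < row w → T b < T w
  larger-above b∈μ c≡ r< with key≤ b∈μ
  ... | inj₁ (Tb≤Tw , Tb≢Tw)     = ≤∧≢⇒< Tb≤Tw Tb≢Tw
  ... | inj₂ (_ , inj₁ (r≤ , _)) = contradiction r≤ (<⇒≱ r<)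
  ... | inj₂ (_ , inj₂ (r≡ , _)) = contradiction r< (<-irrefl r≡)

pivot-exists : ∀ T μ → μ ≢ [] → ∃[ w ] w ∈ μ × Pivot T μ w
pivot-exists T []       μ≢[] = contradiction refl μ≢[]
pivot-exists T (x ∷ xs) _    = w , w∈μ , key-maximal⇒Pivot T (x ∷ xs) w key≤
  where
  w : Box
  w = argmax (key T) x xs
  w∈μ : w ∈ x ∷ xs
  w∈μ with argmax-sel (key T) x xs
  ... | inj₁ w≡x  = here w≡x
  ... | inj₂ w∈xs = there w∈xs
  key≤ : ∀ {b} → b ∈ x ∷ xs → key T b ≤ₖ key T w
  key≤ (here refl) = f[⊥]≤f[argmax] {f = key T} x xs
  key≤ (there b∈)  = All.lookup (f[xs]≤f[argmax] {f = key T} x xs) b∈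

module _ {T μ w} (pivot : Pivot T μ w) where
  open Pivot pivot

  pivot-top : ∀ {X b} → IntervalClosed X → Semistandard T X → X ⊆ μ →
              w ∈ X → b ∈ X → w ⪯ b → b ≡ w
  pivot-top X-skew X-ss@(ss-row , _) X⊆μ w∈X b∈X w⪯b@(r≤ , c≤)
    with m≤n⇒m<n∨m≡n r≤ | m≤n⇒m<n∨m≡n c≤
  ... | inj₁ r< | _      = contradiction (maximal (X⊆μ b∈X))
                                         (<⇒≱ (semistandard-strict-down X-skew X-ss w∈X b∈X w⪯b r<))
  ... | inj₂ r≡ | inj₁ c< = contradiction (ss-row w∈X b∈X r≡ c<)
                                         (<⇒≱ (larger-right (X⊆μ b∈X) (sym r≡) c<))
  ... | inj₂ r≡ | inj₂ c≡ = cong₂ _,_ (sym r≡) (sym c≡)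

  pivot-bottom : ∀ {X a} → IntervalClosed X → ReverseRowStrict T X → X ⊆ μ →
                 w ∈ X → a ∈ X → a ⪯ w → a ≡ w
  pivot-bottom X-skew X-rrs@(_ , rr-col) X⊆μ w∈X a∈X a⪯w@(r≤ , c≤)
    with m≤n⇒m<n∨m≡n c≤ | m≤n⇒m<n∨m≡n r≤
  ... | inj₁ c< | _      = contradiction (maximal (X⊆μ a∈X))
                                         (<⇒≱ (reverseRowStrict-strict-right X-skew X-rrs a∈X w∈X a⪯w c<))
  ... | inj₂ c≡ | inj₁ r< = contradiction (rr-col a∈X w∈X c≡ r<)
                                         (<⇒≱ (larger-above (X⊆μ a∈X) c≡ r<))
  ... | inj₂ c≡ | inj₂ r≡ = cong₂ _,_ r≡ c≡

  semistandard-∷-pivot : ∀ {S} → Semistandard T S → S ⊆ μ → (∀ {b} → b ∈ S → ¬ w ⪯ b) →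
                         Semistandard T (w ∷ S)
  semistandard-∷-pivot {S} (ss-row , ss-col) S⊆μ w⋠S = ss-row′ , ss-col′
    where
    ss-row′ : ∀ {a b} → a ∈ w ∷ S → b ∈ w ∷ S → row a ≡ row b → col a < col b → T a ≤ T b
    ss-row′ (here refl) (here refl) _  c< = contradiction c< (<-irrefl refl)
    ss-row′ (here refl) (there b∈) r≡ c< = contradiction (≤-reflexive r≡ , <⇒≤ c<) (w⋠S b∈)
    ss-row′ (there a∈) (here refl) _  _  = maximal (S⊆μ a∈)
    ss-row′ (there a∈) (there b∈)  r≡ c< = ss-row a∈ b∈ r≡ c<
    ss-col′ : ∀ {a b} → a ∈ w ∷ S → b ∈ w ∷ S → col a ≡ col b → row a < row b → T a < T b
    ss-col′ (here refl) (here refl) _  r< = contradiction r< (<-irrefl refl)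
    ss-col′ (here refl) (there b∈) c≡ r< = contradiction (<⇒≤ r< , ≤-reflexive c≡) (w⋠S b∈)
    ss-col′ (there a∈) (here refl) c≡ r< = larger-above (S⊆μ a∈) c≡ r<
    ss-col′ (there a∈) (there b∈)  c≡ r< = ss-col a∈ b∈ c≡ r<

  reverseRowStrict-∷-pivot : ∀ {R} → ReverseRowStrict T R → R ⊆ μ → (∀ {a} → a ∈ R → ¬ a ⪯ w) →
                             ReverseRowStrict T (w ∷ R)
  reverseRowStrict-∷-pivot {R} (rr-row , rr-col) R⊆μ R⋠w = rr-row′ , rr-col′
    where
    rr-row′ : ∀ {a b} → a ∈ w ∷ R → b ∈ w ∷ R → row a ≡ row b → col a < col b → T b < T a
    rr-row′ (here refl) (here refl) _  c< = contradiction c< (<-irrefl refl)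
    rr-row′ (here refl) (there b∈) r≡ c< = larger-right (R⊆μ b∈) (sym r≡) c<
    rr-row′ (there a∈) (here refl) r≡ c< = contradiction (≤-reflexive r≡ , <⇒≤ c<) (R⋠w a∈)
    rr-row′ (there a∈) (there b∈)  r≡ c< = rr-row a∈ b∈ r≡ c<
    rr-col′ : ∀ {a b} → a ∈ w ∷ R → b ∈ w ∷ R → col a ≡ col b → row a < row b → T b ≤ T a
    rr-col′ (here refl) (here refl) _  r< = contradiction r< (<-irrefl refl)
    rr-col′ (here refl) (there b∈) _  _  = maximal (R⊆μ b∈)
    rr-col′ (there a∈) (here refl) c≡ r< = contradiction (<⇒≤ r< , ≤-reflexive c≡) (R⋠w a∈)
    rr-col′ (there a∈) (there b∈)  c≡ r< = rr-col a∈ b∈ c≡ r<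

module PivotToggle {T μ w S R} (μ-skew : SkewShape μ) (pivot : Pivot T μ w)
                   (μ↭ : μ ↭ w ∷ S ++ R) (uniq : Unique (w ∷ S ++ R)) where

  cover : ∀ {b} → b ∈ μ → b ≡ w ⊎ b ∈ S ⊎ b ∈ R
  cover b∈μ with ∈-resp-↭ μ↭ b∈μ
  ... | here b≡w   = inj₁ b≡w
  ... | there b∈SR = inj₂ (∈-++⁻ S b∈SR)

  S⁺⊆μ : w ∷ S ⊆ μ
  S⁺⊆μ (here refl) = ∈-resp-↭ (↭-sym μ↭) (here refl)
  S⁺⊆μ (there b∈S) = ∈-resp-↭ (↭-sym μ↭) (there (∈-++⁺ˡ b∈S))

  R⁺⊆μ : w ∷ R ⊆ μ
  R⁺⊆μ (here refl) = ∈-resp-↭ (↭-sym μ↭) (here refl)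
  R⁺⊆μ (there b∈R) = ∈-resp-↭ (↭-sym μ↭) (there (∈-++⁺ʳ S b∈R))

  w∉S : ¬ w ∈ S
  w∉S = Unique[x∷xs]⇒x∉xs uniq ∘ ∈-++⁺ˡ

  w∉R : ¬ w ∈ R
  w∉R = Unique[x∷xs]⇒x∉xs uniq ∘ ∈-++⁺ʳ S

  S#R : ∀ {b} → b ∈ S → b ∈ R → ⊥
  S#R b∈S b∈R = Unique-++⇒Disjoint S (AllPairs.tail uniq) (b∈S , b∈R)

  pivot-S→R : Allowed T μ (w ∷ S , R) → Allowed T μ (S , w ∷ R)
  pivot-S→R ((S⁺-skew , R-skew , S⁺-ideal) , S⁺-ss , R-rrs) =
    (S-skew , R⁺-skew , S-ideal) ,
    semistandard-⊆ there S⁺-ss , reverseRowStrict-∷-pivot pivot R-rrs (R⁺⊆μ ∘ there) R⋠w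
    where
    w-top : ∀ {b} → b ∈ w ∷ S → w ⪯ b → b ≡ w
    w-top = pivot-top pivot S⁺-skew S⁺-ss S⁺⊆μ (here refl)
    below-S : ∀ {b c} → b ∈ w ∷ S → b ⪯ c → c ∈ S → b ∈ S
    below-S (here refl) w⪯c c∈S = contradiction (subst (_∈ S) (w-top (there c∈S) w⪯c) c∈S) w∉S
    below-S (there b∈S) _   _   = b∈S
    S-skew : IntervalClosed S
    S-skew a∈S c∈S a⪯b b⪯c = below-S (S⁺-skew (there a∈S) (there c∈S) a⪯b b⪯c) b⪯c c∈S
    S-ideal : OrderIdeal S μ
    S-ideal b∈S a∈μ a⪯b = below-S (S⁺-ideal (there b∈S) a∈μ a⪯b) a⪯b b∈S
    R⋠S⁺ : ∀ {a b} → a ∈ R → b ∈ w ∷ S → ¬ a ⪯ b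
    R⋠S⁺ a∈R b∈S⁺ a⪯b with S⁺-ideal b∈S⁺ (R⁺⊆μ (there a∈R)) a⪯b
    ... | here refl = w∉R a∈R
    ... | there a∈S = S#R a∈S a∈R
    R⋠w : ∀ {a} → a ∈ R → ¬ a ⪯ w
    R⋠w a∈R = R⋠S⁺ a∈R (here refl)
    R⁺-skew : IntervalClosed (w ∷ R)
    R⁺-skew a∈R⁺ c∈R⁺ a⪯b b⪯c
      with cover (μ-skew (R⁺⊆μ a∈R⁺) (R⁺⊆μ c∈R⁺) a⪯b b⪯c) | a∈R⁺
    ... | inj₁ b≡w        | _           = here b≡w
    ... | inj₂ (inj₂ b∈R) | _           = there b∈R
    ... | inj₂ (inj₁ b∈S) | here refl   = contradiction (below-S (here refl) a⪯b b∈S) w∉S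
    ... | inj₂ (inj₁ b∈S) | there a∈R   = contradiction a⪯b (R⋠S⁺ a∈R (there b∈S))

  pivot-R→S : Allowed T μ (S , w ∷ R) → Allowed T μ (w ∷ S , R)
  pivot-R→S ((S-skew , R⁺-skew , S-ideal) , S-ss , R⁺-rrs) =
    (S⁺-skew , R-skew , S⁺-ideal) ,
    semistandard-∷-pivot pivot S-ss (S⁺⊆μ ∘ there) w⋠S , reverseRowStrict-⊆ there R⁺-rrs
    where
    w-bottom : ∀ {a} → a ∈ w ∷ R → a ⪯ w → a ≡ w
    w-bottom = pivot-bottom pivot R⁺-skew R⁺-rrs R⁺⊆μ (here refl)
    above-R : ∀ {a b} → b ∈ w ∷ R → a ⪯ b → a ∈ R → b ∈ R
    above-R (here refl) a⪯w a∈R = contradiction (subst (_∈ R) (w-bottom (there a∈R) a⪯w) a∈R) w∉R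
    above-R (there b∈R) _   _   = b∈R
    R-skew : IntervalClosed R
    R-skew a∈R c∈R a⪯b b⪯c = above-R (R⁺-skew (there a∈R) (there c∈R) a⪯b b⪯c) a⪯b a∈R
    R⋠S⁺ : ∀ {a b} → a ∈ R → b ∈ w ∷ S → ¬ a ⪯ b
    R⋠S⁺ a∈R (here refl) a⪯w = w∉R (above-R (here refl) a⪯w a∈R)
    R⋠S⁺ a∈R (there b∈S) a⪯b = S#R (S-ideal b∈S (R⁺⊆μ (there a∈R)) a⪯b) a∈R
    S⁺-ideal : OrderIdeal (w ∷ S) μ
    S⁺-ideal b∈S⁺ a∈μ a⪯b with cover a∈μ
    ... | inj₁ a≡w        = here a≡w
    ... | inj₂ (inj₁ a∈S) = there a∈S
    ... | inj₂ (inj₂ a∈R) = contradiction a⪯b (R⋠S⁺ a∈R b∈S⁺)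
    S⁺-skew : IntervalClosed (w ∷ S)
    S⁺-skew a∈S⁺ c∈S⁺ a⪯b b⪯c =
      S⁺-ideal c∈S⁺ (μ-skew (S⁺⊆μ a∈S⁺) (S⁺⊆μ c∈S⁺) a⪯b b⪯c) b⪯c
    w⋠S : ∀ {b} → b ∈ S → ¬ w ⪯ b
    w⋠S b∈S w⪯b = w∉S (S-ideal b∈S (S⁺⊆μ (here refl)) w⪯b)

  pivot-cancels : place w (signedIndicator T μ) (S , R) ≡ 0ℤ
  pivot-cancels = trans
    (cong (λ b → signedIndicator T μ (w ∷ S , R) + (if b then sign (length S) else 0ℤ))
          (does-⇔ (mk⇔ pivot-R→S pivot-S→R)
                  (allowed? T μ (S , w ∷ R)) (allowed? T μ (w ∷ S , R))))
    (if-neg-cancel (does (allowed? T μ (w ∷ S , R))) (sign (length S)))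

lemma4p2 : (μ : List Box) → Unique μ → All PositiveBox μ → SkewShape μ → μ ≢ [] →
    (T : Tableau) → (∀ {b} → b ∈ μ → 0 < T b) →
    allowedSignedSum T μ ≡ 0ℤ
-- The positivity of boxes and entries is not needed.
lemma4p2 μ μ-unique _ μ-skew μ≢[] T _
  with w , w∈μ , pivot ← pivot-exists T μ μ≢[]
  with rest , μ↭ ← ∈⇒↭∷ w∈μ = begin
    allowedSignedSum T μ      ≡⟨ sumℤ-map-filter (allowed? T μ) (sign ∘ length ∘ proj₁) (splits μ) ⟩
    Σsplits μ F               ≡⟨ Σsplits-resp-↭ (signedIndicator-invariant T μ) μ↭ ⟩
    Σsplits (w ∷ rest) F      ≡⟨ Σsplits-∷ w rest F ⟩
    Σsplits rest (place w F)  ≡⟨ Σsplits-zero rest cancel ⟩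
    0ℤ                        ∎
  where
  open ≡-Reasoning
  F : List Box × List Box → ℤ
  F = signedIndicator T μ
  cancel : ∀ {S R} → Interleaving S R rest → place w F (S , R) ≡ 0ℤ
  cancel {S} {R} S⋎R =
    PivotToggle.pivot-cancels μ-skew pivot μ↭′ (Unique-resp-↭ (↭⇒↭ₛ μ↭′) μ-unique)
    where
    μ↭′ : μ ↭ w ∷ S ++ R
    μ↭′ = ↭-trans μ↭ (↭-prep w (toPermutation S⋎R))
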